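{- Let $a$ be an element in $\mathbb F_{q^n}^*$ with $\prod_{i=0}^{n-1}(-a)^{q^i}\ne1$. If $L(x)=x^q+ax$, then $\frac{L^{ -1}(x^{q+1})}x$ is a permutation polynomial of $\mathbb F_{q^n}$. If $L(x)=x^{q^{n-1}}+ax$, then $\frac{L^{ -1}(x)}{x^{q+1}}$ is a permutation polynomial of $\mathbb F_{q^n}$.
   Context: $q$ is a prime power and $\mathbb F_{q^n}$ the finite field of order $q^n$. $L^{ -1}$ denotes the compositional inverse of the permutation polynomial $L$ of $\mathbb F_{q^n}$. Polynomials are viewed as maps on $\mathbb F_{q^n}$ (so $x^{q^n}=x$), and $\frac1x$ (or $x^{ -1}$) denotes $x^{q^n-2}$, not a fraction. -}

module Defs where

open import Level using (0ℓ)
open import Data.Nat as ℕ using (ℕ; zero; suc)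
open import Data.Nat.Primality using (Prime)
open import Data.Fin using (Fin)
open import Data.Product using (Σ; ∃; _×_; _,_)
open import Relation.Binary.PropositionalEquality using (_≡_; _≢_)
open import Function.Bundles using (_↔_)
import Algebra.Structures as AS

record FiniteField : Set₁ where
  field
    Carrier : Set
    _+_ _*_ : Carrier → Carrier → Carrier
    -_      : Carrier → Carrier
    0# 1#   : Carrier
    isCommutativeRing : AS.IsCommutativeRing {A = Carrier} _≡_ _+_ _*_ -_ 0# 1#
    0≢1     : 0# ≢ 1#
    inverse : ∀ x → x ≢ 0# → Σ Carrier (λ y → x * y ≡ 1#)
    size    : ℕ
    enum    : Carrier ↔ Fin size

  infixl 7 _*_
  infixl 6 _+_

  _^_ : Carrier → ℕ → Carrier
  x ^ zero  = 1#
  x ^ suc m = x * (x ^ m)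
  infixr 8 _^_

  prod : ℕ → (ℕ → Carrier) → Carrier
  prod zero    f = 1#
  prod (suc k) f = prod k f * f k

IsPrimePower : ℕ → Set
IsPrimePower q = Σ ℕ (λ p → Σ ℕ (λ k → Prime p × 1 ℕ.≤ k × q ≡ p ℕ.^ k))

module Submission where

-- Both maps fix 0 and send nonzero elements to nonzero elements, so it suffices to show that two
-- nonzero arguments with the same image y ≠ 0 coincide. As Linv is a right inverse of L on a finite
-- field, L is a permutation fixing 0, so L z = 0 forces z = 0. For the first map,
-- y = L⁻¹(x^(q+1))/x turns into y^q u + a y u^q = 1 with u = 1/x; for fixed y the left side is
-- additive in u with trivial kernel, since at d ≠ 0 it equals L(y/d) d^(q+1). For the second map,
-- y = L⁻¹(x)/x^(q+1) turns into y x + a^q y^q x^(q²) = 1; the left side is additive in x with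
-- trivial kernel, since d^q (y d + a^q y^q d^(q²)) = L(y d^(q+1))^q. Either way y determines x.

open import Defs
open import Level using (0ℓ)
open import Data.Nat as ℕ using (ℕ; zero; suc; _≤_; _<_; z≤n; s≤s; _∸_; _!; NonZero)
import Data.Nat.Properties as ℕₚ
open import Data.Nat.Divisibility using (_∣_; divides; ∣1⇒≡1; ∣⇒≤; m∣m*n)
open import Data.Nat.DivMod using (m*[n/m]≡n)
open import Data.Nat.Primality using (Prime; euclidsLemma; prime⇒nonTrivial; prime⇒nonZero)
open import Data.Nat.Combinatorics using (_C_; nCk≡n!/k![n-k]!; k![n∸k]!∣n!; nCn≡1)
open import Data.Fin as Fin using (Fin; toℕ; fromℕ; inject₁; punchIn)
import Data.Fin.Properties as Finₚ
open import Data.Fin.Permutation using (Permutation; permutation)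
open import Data.Maybe using (Maybe; nothing; just)
open import Data.Product using (_×_; _,_; ∃; proj₂)
open import Data.Sum using (inj₁; inj₂)
open import Relation.Nullary using (¬_; Dec; yes; no; map′; contradiction)
open import Relation.Binary.PropositionalEquality
  using (_≡_; _≢_; refl; sym; trans; cong; cong₂; subst; module ≡-Reasoning)
open import Function.Base using (_∘′_)
open import Function.Bundles using (Inverse)
open import Function.Definitions using (Injective; Surjective; Bijective)
open import Algebra.Bundles using (CommutativeRing; CommutativeMonoid)
import Algebra.Properties.CommutativeMonoid.Sum as CommutativeMonoidSum
import Algebra.Properties.CommutativeSemiring.Binomial as Binomial
import Algebra.Properties.Group as GroupProperties
import Algebra.Properties.Semiring.Exp as SemiringExp
import Algebra.Properties.Semiring.Mult as SemiringMult
import Algebra.Solver.Ring.NaturalCoefficients as NaturalCoefficients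

Fin-injective⇒surjective : ∀ {m} (f : Fin m → Fin m) → Injective _≡_ _≡_ f →
                           ∀ y → ∃ λ x → f x ≡ y
Fin-injective⇒surjective {zero} f inj ()
Fin-injective⇒surjective {suc m} f inj y with Finₚ.any? (λ i → f i Finₚ.≟ y)
... | yes hit = hit
... | no miss = contradiction (Finₚ.injective⇒≤ punchOut-inj) (ℕₚ.<-irrefl refl)
  where
  f≢y : ∀ i → y ≢ f i
  f≢y i eq = miss (i , sym eq)
  punchOut-inj : Injective _≡_ _≡_ (λ i → Fin.punchOut (f≢y i))
  punchOut-inj {i} {j} eq = inj (Finₚ.punchOut-injective (f≢y i) (f≢y j) eq)

distinct⇒2≤ : ∀ {m} {i j : Fin m} → i ≢ j → 2 ≤ m
distinct⇒2≤ {i = Fin.zero}  {Fin.zero}  i≢j = contradiction refl i≢j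
distinct⇒2≤ {i = Fin.zero}  {Fin.suc j} _   = s≤s (ℕ.>-nonZero⁻¹ _ {{Finₚ.nonZeroIndex j}})
distinct⇒2≤ {i = Fin.suc i} _               = s≤s (ℕ.>-nonZero⁻¹ _ {{Finₚ.nonZeroIndex i}})

n∣n! : ∀ n .{{_ : NonZero n}} → n ∣ n !
n∣n! (suc n) = m∣m*n (n !)

prime∤! : ∀ {p} → Prime p → ∀ m → m < p → ¬ p ∣ m !
prime∤! pp zero    _   p∣1 = ℕ.nonTrivial⇒≢1 {{prime⇒nonTrivial pp}} (∣1⇒≡1 p∣1)
prime∤! pp (suc m) m<p p∣m! with euclidsLemma (suc m) (m !) pp p∣m!
... | inj₁ p∣1+m = ℕₚ.<-irrefl refl (ℕₚ.<-≤-trans m<p (∣⇒≤ p∣1+m))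
... | inj₂ p∣m!  = prime∤! pp m (ℕₚ.<-trans (ℕₚ.n<1+n m) m<p) p∣m!

prime∣C : ∀ {p k} → Prime p → 0 < k → k < p → p ∣ p C k
prime∣C {p} {k} pp 0<k k<p
  with euclidsLemma (k ! ℕ.* (p ∸ k) !) (p C k) pp (subst (p ∣_) (sym factorials*C) (n∣n! p))
  where
  instance
    _ : NonZero p
    _ = prime⇒nonZero pp
    _ : NonZero (k ! ℕ.* (p ∸ k) !)
    _ = ℕₚ.m*n≢0 (k !) ((p ∸ k) !) {{ℕₚ._!≢0 k}} {{ℕₚ._!≢0 (p ∸ k)}}
  factorials*C : k ! ℕ.* (p ∸ k) ! ℕ.* (p C k) ≡ p !
  factorials*C = trans (cong (k ! ℕ.* (p ∸ k) ! ℕ.*_) (nCk≡n!/k![n-k]! (ℕₚ.<⇒≤ k<p)))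
                       (m*[n/m]≡n (k![n∸k]!∣n! (ℕₚ.<⇒≤ k<p)))
... | inj₂ p∣C = p∣C
... | inj₁ p∣k![p∸k]! with euclidsLemma (k !) ((p ∸ k) !) pp p∣k![p∸k]!
...   | inj₁ p∣k!     = contradiction p∣k! (prime∤! pp k k<p)
...   | inj₂ p∣[p∸k]! = contradiction p∣[p∸k]! (prime∤! pp (p ∸ k) (ℕₚ.∸-monoʳ-< {p} {k} {0} 0<k (ℕₚ.<⇒≤ k<p)))

primePower⇒nonZero : ∀ {q} → IsPrimePower q → NonZero q
primePower⇒nonZero (p , k , pp , _ , refl) = ℕₚ.m^n≢0 p k {{prime⇒nonZero pp}}

module FieldProperties (F : FiniteField) where
  open FiniteField F public

  ring : CommutativeRing 0ℓ 0ℓ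
  ring = record { isCommutativeRing = isCommutativeRing }

  open CommutativeRing ring public
    using ( +-assoc; +-comm; +-identityˡ; +-identityʳ; -‿inverseˡ; -‿inverseʳ
          ; *-assoc; *-comm; *-identityˡ; *-identityʳ; distribʳ; zeroˡ; zeroʳ )
  open SemiringMult (CommutativeRing.semiring ring) public
    using (×-assoc-*; ×1-homo-*) renaming (_×_ to _·_)

  private
    ·1-equal? : ∀ m n → Maybe (m · 1# ≡ n · 1#)
    ·1-equal? m n with m ℕₚ.≟ n
    ... | yes m≡n = just (cong (_· 1#) m≡n)
    ... | no _    = nothing

  open NaturalCoefficients (CommutativeRing.commutativeSemiring ring) ·1-equal? public
    using (solve; _:=_; _:+_; _:*_)
  open GroupProperties (CommutativeRing.+-group ring) using (x∙y⁻¹≈ε⇒x≈y; ∙-cancelʳ)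

  open Inverse enum using (to; from; strictlyInverseˡ; strictlyInverseʳ)

  to-injective : Injective _≡_ _≡_ to
  to-injective {x} {y} eq = trans (sym (strictlyInverseʳ x)) (trans (cong from eq) (strictlyInverseʳ y))

  infix 4 _≟_
  _≟_ : (x y : Carrier) → Dec (x ≡ y)
  x ≟ y = map′ to-injective (cong to) (to x Finₚ.≟ to y)

  injective⇒bijective : (f : Carrier → Carrier) → Injective _≡_ _≡_ f → Bijective _≡_ _≡_ f
  injective⇒bijective f f-inj = f-inj , surjective
    where
    f̂ : Fin size → Fin size
    f̂ i = to (f (from i))
    f̂-inj : Injective _≡_ _≡_ f̂
    f̂-inj {i} {j} eq = trans (sym (strictlyInverseˡ i))
                         (trans (cong to (f-inj (to-injective eq))) (strictlyInverseˡ j))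
    surjective : Surjective _≡_ _≡_ f
    surjective y with i , f̂i≡y ← Fin-injective⇒surjective f̂ f̂-inj (to y) =
      from i , λ { refl → to-injective f̂i≡y }

  2≤size : 2 ≤ size
  2≤size = distinct⇒2≤ (λ eq → 0≢1 (to-injective eq))

  *-cancelˡ : ∀ {x y z} → x ≢ 0# → x * y ≡ x * z → y ≡ z
  *-cancelˡ {x} {y} {z} x≢0 xy≡xz with x⁻ , xx⁻≡1 ← inverse x x≢0 = begin
    y              ≡⟨ sym (*-identityˡ y) ⟩
    1# * y         ≡⟨ cong (_* y) (sym xx⁻≡1) ⟩
    x * x⁻ * y     ≡⟨ solve 3 (λ x x⁻ y → x :* x⁻ :* y := x⁻ :* (x :* y)) refl x x⁻ y ⟩
    x⁻ * (x * y)   ≡⟨ cong (x⁻ *_) xy≡xz ⟩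
    x⁻ * (x * z)   ≡⟨ solve 3 (λ x x⁻ z → x⁻ :* (x :* z) := x :* x⁻ :* z) refl x x⁻ z ⟩
    x * x⁻ * z     ≡⟨ cong (_* z) xx⁻≡1 ⟩
    1# * z         ≡⟨ *-identityˡ z ⟩
    z              ∎
    where open ≡-Reasoning

  *-nonzero : ∀ {x y} → x ≢ 0# → y ≢ 0# → x * y ≢ 0#
  *-nonzero {x} x≢0 y≢0 xy≡0 = y≢0 (*-cancelˡ x≢0 (trans xy≡0 (sym (zeroʳ x))))

  ^-nonzero : ∀ {x} m → x ≢ 0# → x ^ m ≢ 0#
  ^-nonzero zero    _   1≡0 = 0≢1 (sym 1≡0)
  ^-nonzero (suc m) x≢0     = *-nonzero x≢0 (^-nonzero m x≢0)

  ^≡0⇒≡0 : ∀ {x} m → x ^ m ≡ 0# → x ≡ 0#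
  ^≡0⇒≡0 {x} m xᵐ≡0 with x ≟ 0#
  ... | yes x≡0 = x≡0
  ... | no  x≢0 = contradiction xᵐ≡0 (^-nonzero m x≢0)

  0^m≡0 : ∀ m .{{_ : NonZero m}} → 0# ^ m ≡ 0#
  0^m≡0 (suc m) = zeroˡ (0# ^ m)

  1^m≡1 : ∀ m → 1# ^ m ≡ 1#
  1^m≡1 zero    = refl
  1^m≡1 (suc m) = trans (*-identityˡ _) (1^m≡1 m)

  ^-homo-* : ∀ x m n → x ^ (m ℕ.+ n) ≡ x ^ m * x ^ n
  ^-homo-* x zero    n = sym (*-identityˡ _)
  ^-homo-* x (suc m) n = trans (cong (x *_) (^-homo-* x m n)) (sym (*-assoc _ _ _))

  ^-assocʳ : ∀ x m n → (x ^ m) ^ n ≡ x ^ (m ℕ.* n)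
  ^-assocʳ x m zero    = cong (x ^_) (sym (ℕₚ.*-zeroʳ m))
  ^-assocʳ x m (suc n) = begin
    x ^ m * (x ^ m) ^ n     ≡⟨ cong (x ^ m *_) (^-assocʳ x m n) ⟩
    x ^ m * x ^ (m ℕ.* n)   ≡⟨ ^-homo-* x m (m ℕ.* n) ⟨
    x ^ (m ℕ.+ m ℕ.* n)     ≡⟨ cong (x ^_) (ℕₚ.*-suc m n) ⟨
    x ^ (m ℕ.* suc n)       ∎
    where open ≡-Reasoning

  ^-distrib-* : ∀ x y m → (x * y) ^ m ≡ x ^ m * y ^ m
  ^-distrib-* x y zero    = sym (*-identityˡ 1#)
  ^-distrib-* x y (suc m) = trans (cong (x * y *_) (^-distrib-* x y m))
    (solve 4 (λ x y xᵐ yᵐ → x :* y :* (xᵐ :* yᵐ) := x :* xᵐ :* (y :* yᵐ)) refl x y (x ^ m) (y ^ m))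

  x^[m+1]≡x^m*x : ∀ x m → x ^ (m ℕ.+ 1) ≡ x ^ m * x
  x^[m+1]≡x^m*x x m = trans (^-homo-* x m 1) (cong (x ^ m *_) (*-identityʳ x))

  -- Sums over the field: the characteristic and Fermat's little theorem

  module _ (M : CommutativeMonoid 0ℓ 0ℓ) where
    private module M = CommutativeMonoid M
    open CommutativeMonoidSum M using (sum; sum-permute; sum-cong-≗)

    sum-invariant : (σ σ⁻ : Carrier → Carrier) → (∀ x → σ (σ⁻ x) ≡ x) → (∀ x → σ⁻ (σ x) ≡ x) →
                    (f : Carrier → M.Carrier) →
                    M._≈_ (sum (λ i → f (from i))) (sum (λ i → f (σ (from i))))
    sum-invariant σ σ⁻ σσ⁻≡id σ⁻σ≡id f =
      M.trans (sum-permute (λ i → f (from i)) π)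
              (M.reflexive (sum-cong-≗ (λ i → cong f (strictlyInverseʳ (σ (from i))))))
      where
      conj : (Carrier → Carrier) → Fin size → Fin size
      conj τ i = to (τ (from i))
      conj-inverse : ∀ τ τ⁻ → (∀ x → τ (τ⁻ x) ≡ x) → ∀ i → conj τ (conj τ⁻ i) ≡ i
      conj-inverse τ τ⁻ ττ⁻≡id i = begin
        to (τ (from (to (τ⁻ (from i)))))   ≡⟨ cong (λ x → to (τ x)) (strictlyInverseʳ _) ⟩
        to (τ (τ⁻ (from i)))               ≡⟨ cong to (ττ⁻≡id (from i)) ⟩
        to (from i)                        ≡⟨ strictlyInverseˡ i ⟩
        i                                  ∎
        where open ≡-Reasoning
      π : Permutation size size
      π = permutation (conj σ) (conj σ⁻) (conj-inverse σ σ⁻ σσ⁻≡id) (conj-inverse σ⁻ σ σ⁻σ≡id)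

  +-undo : ∀ {c c′} → c + c′ ≡ 0# → ∀ x → c + (c′ + x) ≡ x
  +-undo cc′≡0 x = trans (sym (+-assoc _ _ x)) (trans (cong (_+ x) cc′≡0) (+-identityˡ x))

  *-undo : ∀ {c c′} → c * c′ ≡ 1# → ∀ x → c * (c′ * x) ≡ x
  *-undo cc′≡1 x = trans (sym (*-assoc _ _ x)) (trans (cong (_* x) cc′≡1) (*-identityˡ x))

  private
    module Sum = CommutativeMonoidSum (CommutativeRing.+-commutativeMonoid ring)
    module Product = CommutativeMonoidSum (CommutativeRing.*-commutativeMonoid ring)

  size·1≡0 : size · 1# ≡ 0#
  size·1≡0 = ∙-cancelʳ S _ _ (begin
    size · 1# + S                      ≡⟨ cong (_+ S) (Sum.sum-replicate size) ⟨
    Sum.sum {size} (λ _ → 1#) + S       ≡⟨ Sum.∑-distrib-+ (λ _ → 1#) from ⟨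
    Sum.sum (λ i → 1# + from i)         ≡⟨ sum-invariant (CommutativeRing.+-commutativeMonoid ring) (1# +_) (- 1# +_) (+-undo (-‿inverseʳ 1#)) (+-undo (-‿inverseˡ 1#)) (λ x → x) ⟨
    S                                  ≡⟨ +-identityˡ S ⟨
    0# + S                             ∎)
    where
    open ≡-Reasoning
    S : Carrier
    S = Sum.sum from

  unit : Carrier → Carrier
  unit x with x ≟ 0#
  ... | yes _ = 1#
  ... | no  _ = x

  unit-nonzero : ∀ x → unit x ≢ 0#
  unit-nonzero x with x ≟ 0#
  ... | yes _   = λ 1≡0 → 0≢1 (sym 1≡0)
  ... | no  x≢0 = x≢0

  scale : Carrier → Carrier → Carrier
  scale a x with x ≟ 0#
  ... | yes _ = 1#
  ... | no  _ = a

  unit-scale : ∀ {a} x → a ≢ 0# → unit (a * x) ≡ scale a x * unit x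
  unit-scale {a} x a≢0 with x ≟ 0# | a * x ≟ 0#
  ... | yes _   | yes _    = sym (*-identityˡ 1#)
  ... | yes x≡0 | no  ax≢0 = contradiction (trans (cong (a *_) x≡0) (zeroʳ a)) ax≢0
  ... | no  x≢0 | yes ax≡0 = contradiction ax≡0 (*-nonzero a≢0 x≢0)
  ... | no  _   | no  _    = refl

  ∏-nonzero : ∀ {m} (g : Fin m → Carrier) → (∀ i → g i ≢ 0#) → Product.sum g ≢ 0#
  ∏-nonzero {zero}  g _     1≡0 = 0≢1 (sym 1≡0)
  ∏-nonzero {suc m} g g≢0 = *-nonzero (g≢0 Fin.zero) (∏-nonzero (g ∘′ Fin.suc) (λ i → g≢0 (Fin.suc i)))

  ∏-const : ∀ a m → Product.sum {m} (λ _ → a) ≡ a ^ m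
  ∏-const a zero    = refl
  ∏-const a (suc m) = cong (a *_) (∏-const a m)

  ∏-all-but-one : ∀ a {m} (g : Fin m → Carrier) (i₀ : Fin m) →
                  g i₀ ≡ 1# → (∀ j → j ≢ i₀ → g j ≡ a) → Product.sum g ≡ a ^ (m ∸ 1)
  ∏-all-but-one a {suc m} g i₀ gi₀≡1 gj≡a = begin
    Product.sum g                                ≡⟨ Product.sum-remove g ⟩
    g i₀ * Product.sum (λ j → g (punchIn i₀ j))  ≡⟨ cong₂ _*_ gi₀≡1 (Product.sum-cong-≗ (λ j → gj≡a _ (Finₚ.punchInᵢ≢i i₀ j))) ⟩
    1# * Product.sum {m} (λ _ → a)               ≡⟨ *-identityˡ _ ⟩
    Product.sum {m} (λ _ → a)                    ≡⟨ ∏-const a m ⟩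
    a ^ m                                   ∎
    where open ≡-Reasoning

  ∏-scale : ∀ a → Product.sum (λ i → scale a (from i)) ≡ a ^ (size ∸ 1)
  ∏-scale a = ∏-all-but-one a _ (to 0#) scale-at-0 scale-elsewhere
    where
    scale-at-0 : scale a (from (to 0#)) ≡ 1#
    scale-at-0 with from (to 0#) ≟ 0#
    ... | yes _    = refl
    ... | no  0≢0  = contradiction (strictlyInverseʳ 0#) 0≢0
    scale-elsewhere : ∀ j → j ≢ to 0# → scale a (from j) ≡ a
    scale-elsewhere j j≢0 with from j ≟ 0#
    ... | yes j≡0 = contradiction (trans (sym (strictlyInverseˡ j)) (cong to j≡0)) j≢0
    ... | no  _   = refl

  -- Scaling by a permutes the field; as unit replaces 0 by 1, the product of all unit x picks up
  -- exactly the factor a ^ (size ∸ 1).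
  fermat : ∀ {a} → a ≢ 0# → a ^ (size ∸ 1) ≡ 1#
  fermat {a} a≢0 with a⁻ , aa⁻≡1 ← inverse a a≢0 =
    *-cancelˡ P≢0 (trans (*-comm P _) (trans aᵐP≡P (sym (*-identityʳ P))))
    where
    open ≡-Reasoning
    P : Carrier
    P = Product.sum (λ i → unit (from i))
    P≢0 : P ≢ 0#
    P≢0 = ∏-nonzero _ (λ i → unit-nonzero (from i))
    aᵐP≡P : a ^ (size ∸ 1) * P ≡ P
    aᵐP≡P = begin
      a ^ (size ∸ 1) * P                                              ≡⟨ cong (_* P) (∏-scale a) ⟨
      Product.sum (λ i → scale a (from i)) * P                            ≡⟨ Product.∑-distrib-+ (λ i → scale a (from i)) _ ⟨
      Product.sum (λ i → scale a (from i) * unit (from i))                ≡⟨ Product.sum-cong-≗ (λ i → unit-scale (from i) a≢0) ⟨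
      Product.sum (λ i → unit (a * from i))                               ≡⟨ sum-invariant (CommutativeRing.*-commutativeMonoid ring) (a *_) (a⁻ *_) (*-undo aa⁻≡1) (*-undo (trans (*-comm a⁻ a) aa⁻≡1)) unit ⟨
      P                                                               ∎

  -- the paper's x⁻¹; its junk value at 0 is 0 ^ (size ∸ 2)
  _⁻¹ : Carrier → Carrier
  x ⁻¹ = x ^ (size ∸ 2)

  ⁻¹-inverseʳ : ∀ {x} → x ≢ 0# → x * x ⁻¹ ≡ 1#
  ⁻¹-inverseʳ {x} x≢0 = trans (cong (x ^_) (sym (ℕₚ.+-∸-assoc 1 2≤size))) (fermat x≢0)

  ⁻¹-nonzero : ∀ {x} → x ≢ 0# → x ⁻¹ ≢ 0#
  ⁻¹-nonzero = ^-nonzero (size ∸ 2)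

  ⁻¹-injective : ∀ {x₁ x₂} → x₁ ≢ 0# → x₂ ≢ 0# → x₁ ⁻¹ ≡ x₂ ⁻¹ → x₁ ≡ x₂
  ⁻¹-injective {x₁} {x₂} x₁≢0 x₂≢0 x₁⁻¹≡x₂⁻¹ = *-cancelˡ (⁻¹-nonzero x₁≢0) (begin
    x₁ ⁻¹ * x₁   ≡⟨ *-comm _ _ ⟩
    x₁ * x₁ ⁻¹   ≡⟨ ⁻¹-inverseʳ x₁≢0 ⟩
    1#           ≡⟨ ⁻¹-inverseʳ x₂≢0 ⟨
    x₂ * x₂ ⁻¹   ≡⟨ cong (x₂ *_) x₁⁻¹≡x₂⁻¹ ⟨
    x₂ * x₁ ⁻¹   ≡⟨ *-comm _ _ ⟩
    x₁ ⁻¹ * x₂   ∎)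
    where open ≡-Reasoning

  x^size≡x : ∀ x → x ^ size ≡ x
  x^size≡x x with x ≟ 0#
  ... | yes refl = trans (cong (0# ^_) (sym (ℕₚ.m+[n∸m]≡n 2≤size))) (zeroˡ _)
  ... | no  x≢0  = trans (cong (x ^_) (sym (ℕₚ.m+[n∸m]≡n 2≤size)))
                         (trans (cong (x *_) (⁻¹-inverseʳ x≢0)) (*-identityʳ x))

  -- The Frobenius map

  ·1-homo-^ : ∀ p e → (p ℕ.^ e) · 1# ≡ (p · 1#) ^ e
  ·1-homo-^ p zero    = +-identityʳ 1#
  ·1-homo-^ p (suc e) = trans (×1-homo-* p (p ℕ.^ e)) (cong ((p · 1#) *_) (·1-homo-^ p e))

  characteristic : ∀ {p e} → size ≡ p ℕ.^ e → p · 1# ≡ 0#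
  characteristic {p} {e} size≡pᵉ =
    ^≡0⇒≡0 e (trans (sym (·1-homo-^ p e)) (trans (cong (_· 1#) (sym size≡pᵉ)) size·1≡0))

  module Frobenius {p} (pp : Prime p) (p·1≡0 : p · 1# ≡ 0#) where
    private
      module Exp = SemiringExp (CommutativeRing.semiring ring)

      ^≡Exp^ : ∀ x m → x ^ m ≡ x Exp.^ m
      ^≡Exp^ x zero    = refl
      ^≡Exp^ x (suc m) = cong (x *_) (^≡Exp^ x m)

    p∣m⇒m·x≡0 : ∀ {m} → p ∣ m → ∀ x → m · x ≡ 0#
    p∣m⇒m·x≡0 (divides c refl) x = begin
      (c ℕ.* p) · x                ≡⟨ cong ((c ℕ.* p) ·_) (*-identityˡ x) ⟨
      (c ℕ.* p) · (1# * x)         ≡⟨ ×-assoc-* (c ℕ.* p) 1# x ⟨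
      (c ℕ.* p) · 1# * x           ≡⟨ cong (_* x) (×1-homo-* c p) ⟩
      c · 1# * (p · 1#) * x        ≡⟨ cong (λ z → c · 1# * z * x) p·1≡0 ⟩
      c · 1# * 0# * x              ≡⟨ cong (_* x) (zeroʳ (c · 1#)) ⟩
      0# * x                       ≡⟨ zeroˡ x ⟩
      0#                           ∎
      where open ≡-Reasoning

    frobenius : ∀ x y → (x + y) ^ p ≡ x ^ p + y ^ p
    frobenius x y with s≤s (s≤s {n = r} _) ← ℕ.nonTrivial⇒n>1 p {{prime⇒nonTrivial pp}} = begin
      (x + y) ^ p                                          ≡⟨ ^≡Exp^ (x + y) p ⟩
      (x + y) Exp.^ p                                      ≡⟨ Binomial.theorem (CommutativeRing.commutativeSemiring ring) p x y ⟩
      term 0 + Sum.sum {p} (λ i → term (suc (toℕ i)))       ≡⟨ cong (term 0 +_) (Sum.sum-init-last {suc r} (λ i → term (suc (toℕ i)))) ⟩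
      term 0 + (Sum.sum {suc r} (λ i → term (suc (toℕ (inject₁ i)))) + term (suc (toℕ (fromℕ (suc r)))))
        ≡⟨ cong₂ (λ u v → term 0 + (u + term (suc v))) middle≡0 (Finₚ.toℕ-fromℕ (suc r)) ⟩
      term 0 + (0# + term p)                               ≡⟨ cong₂ _+_ term₀ (trans (+-identityˡ _) termₚ) ⟩
      y ^ p + x ^ p                                        ≡⟨ +-comm _ _ ⟩
      x ^ p + y ^ p                                        ∎
      where
      open ≡-Reasoning
      binomial : ℕ → Carrier
      binomial k = x Exp.^ k * y Exp.^ (p ∸ k)
      term : ℕ → Carrier
      term k = (p C k) · binomial k
      middle≡0 : Sum.sum {suc r} (λ i → term (suc (toℕ (inject₁ i)))) ≡ 0#
      middle≡0 = trans (Sum.sum-cong-≗ {suc r} (λ i → p∣m⇒m·x≡0 (prime∣C pp (s≤s z≤n) (s≤s (Finₚ.inject₁ℕ< i))) (binomial (suc (toℕ (inject₁ i))))))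
                       (Sum.sum-replicate-zero (suc r))
      term₀ : term 0 ≡ y ^ p
      term₀ = trans (+-identityʳ _) (trans (*-identityˡ _) (sym (^≡Exp^ y p)))
      termₚ : term p ≡ x ^ p
      termₚ = begin
        term p                           ≡⟨ cong₂ (λ c e → c · (x Exp.^ p * y Exp.^ e)) (nCn≡1 p) (ℕₚ.n∸n≡0 p) ⟩
        1 · (x Exp.^ p * 1#)             ≡⟨ +-identityʳ _ ⟩
        x Exp.^ p * 1#                   ≡⟨ *-identityʳ _ ⟩
        x Exp.^ p                        ≡⟨ ^≡Exp^ x p ⟨
        x ^ p                            ∎

    frobenius-^ : ∀ k x y → (x + y) ^ (p ℕ.^ k) ≡ x ^ (p ℕ.^ k) + y ^ (p ℕ.^ k)
    frobenius-^ zero    x y = distribʳ 1# x y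
    frobenius-^ (suc k) x y = begin
      (x + y) ^ (p ℕ.* p ℕ.^ k)                  ≡⟨ ^-assocʳ (x + y) p (p ℕ.^ k) ⟨
      ((x + y) ^ p) ^ (p ℕ.^ k)                  ≡⟨ cong (_^ (p ℕ.^ k)) (frobenius x y) ⟩
      (x ^ p + y ^ p) ^ (p ℕ.^ k)                ≡⟨ frobenius-^ k (x ^ p) (y ^ p) ⟩
      (x ^ p) ^ (p ℕ.^ k) + (y ^ p) ^ (p ℕ.^ k)  ≡⟨ cong₂ _+_ (^-assocʳ x p (p ℕ.^ k)) (^-assocʳ y p (p ℕ.^ k)) ⟩
      x ^ (p ℕ.* p ℕ.^ k) + y ^ (p ℕ.* p ℕ.^ k)  ∎
      where open ≡-Reasoning

  frobenius-primePower : ∀ {q m} → IsPrimePower q → size ≡ q ℕ.^ m → ∀ x y → (x + y) ^ q ≡ x ^ q + y ^ q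
  frobenius-primePower {m = m} (p , k , pp , _ , refl) size≡qᵐ =
    Frobenius.frobenius-^ pp (characteristic {p} {k ℕ.* m} (trans size≡qᵐ (ℕₚ.^-*-assoc p k m))) k


  -- Injectivity criteria

  module RightInverse (L L⁻ : Carrier → Carrier) (L∘L⁻ : ∀ y → L (L⁻ y) ≡ y) where
    L⁻-injective : Injective _≡_ _≡_ L⁻
    L⁻-injective {y} {y′} eq = trans (sym (L∘L⁻ y)) (trans (cong L eq) (L∘L⁻ y′))

    L⁻∘L : ∀ x → L⁻ (L x) ≡ x
    L⁻∘L x with y , L⁻y≡x ← proj₂ (injective⇒bijective L⁻ L⁻-injective) x = begin
      L⁻ (L x)        ≡⟨ cong (λ z → L⁻ (L z)) (L⁻y≡x refl) ⟨
      L⁻ (L (L⁻ y))   ≡⟨ cong L⁻ (L∘L⁻ y) ⟩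
      L⁻ y            ≡⟨ L⁻y≡x refl ⟩
      x               ∎
      where open ≡-Reasoning

    L-injective : Injective _≡_ _≡_ L
    L-injective {x₁} {x₂} eq = trans (sym (L⁻∘L x₁)) (trans (cong L⁻ eq) (L⁻∘L x₂))

    module _ (L0≡0 : L 0# ≡ 0#) where
      L⁻0≡0 : L⁻ 0# ≡ 0#
      L⁻0≡0 = trans (cong L⁻ (sym L0≡0)) (L⁻∘L 0#)

      L≡0⇒≡0 : ∀ {z} → L z ≡ 0# → z ≡ 0#
      L≡0⇒≡0 Lz≡0 = L-injective (trans Lz≡0 (sym L0≡0))

      L⁻-nonzero : ∀ {y} → y ≢ 0# → L⁻ y ≢ 0#
      L⁻-nonzero {y} y≢0 L⁻y≡0 = y≢0 (trans (sym (L∘L⁻ y)) (trans (cong L L⁻y≡0) L0≡0))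

  additive-injective : (φ : Carrier → Carrier) → (∀ u v → φ (u + v) ≡ φ u + φ v) →
                       (∀ d → φ d ≡ 0# → d ≡ 0#) → Injective _≡_ _≡_ φ
  additive-injective φ φ-additive φ-kernel {u} {v} φu≡φv =
    x∙y⁻¹≈ε⇒x≈y u v (φ-kernel (u + - v) (∙-cancelʳ (φ v) _ _ φ[u-v]+φv≡0+φv))
    where
    open ≡-Reasoning
    φ[u-v]+φv≡0+φv : φ (u + - v) + φ v ≡ 0# + φ v
    φ[u-v]+φv≡0+φv = begin
      φ (u + - v) + φ v   ≡⟨ φ-additive (u + - v) v ⟨
      φ (u + - v + v)     ≡⟨ cong φ (trans (+-assoc u (- v) v) (cong (u +_) (-‿inverseˡ v))) ⟩
      φ (u + 0#)          ≡⟨ cong φ (+-identityʳ u) ⟩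
      φ u                 ≡⟨ φu≡φv ⟩
      φ v                 ≡⟨ +-identityˡ (φ v) ⟨
      0# + φ v            ∎

  nonzero-injective⇒injective : (f : Carrier → Carrier) → f 0# ≡ 0# → (∀ {x} → x ≢ 0# → f x ≢ 0#) →
                                (∀ {x₁ x₂} → x₁ ≢ 0# → x₂ ≢ 0# → f x₁ ≡ f x₂ → x₁ ≡ x₂) →
                                Injective _≡_ _≡_ f
  nonzero-injective⇒injective f f0≡0 f-nonzero f-inj {x₁} {x₂} fx₁≡fx₂ with x₁ ≟ 0# | x₂ ≟ 0#
  ... | yes x₁≡0 | yes x₂≡0 = trans x₁≡0 (sym x₂≡0)
  ... | yes refl | no  x₂≢0 = contradiction (trans (sym fx₁≡fx₂) f0≡0) (f-nonzero x₂≢0)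
  ... | no  x₁≢0 | yes refl = contradiction (trans fx₁≡fx₂ f0≡0) (f-nonzero x₁≢0)
  ... | no  x₁≢0 | no  x₂≢0 = f-inj x₁≢0 x₂≢0 fx₁≡fx₂

  -- If f x = y forces the additive equation E y (g x) = 1, then f x₁ = f x₂ gives g x₁ = g x₂.
  linearisable⇒bijective : (f g : Carrier → Carrier) (E : Carrier → Carrier → Carrier) →
    f 0# ≡ 0# → (∀ {x} → x ≢ 0# → f x ≢ 0#) →
    (∀ {x₁ x₂} → x₁ ≢ 0# → x₂ ≢ 0# → g x₁ ≡ g x₂ → x₁ ≡ x₂) →
    (∀ y u v → E y (u + v) ≡ E y u + E y v) → (∀ {y} → y ≢ 0# → ∀ d → E y d ≡ 0# → d ≡ 0#) →
    (∀ {x} → x ≢ 0# → E (f x) (g x) ≡ 1#) → Bijective _≡_ _≡_ f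
  linearisable⇒bijective f g E f0≡0 f-nonzero g-injective E-additive E-kernel E[f,g]≡1 =
    injective⇒bijective f (nonzero-injective⇒injective f f0≡0 f-nonzero f-injective)
    where
    f-injective : ∀ {x₁ x₂} → x₁ ≢ 0# → x₂ ≢ 0# → f x₁ ≡ f x₂ → x₁ ≡ x₂
    f-injective {x₁} {x₂} x₁≢0 x₂≢0 fx₁≡fx₂ = g-injective x₁≢0 x₂≢0
      (additive-injective (E (f x₁)) (E-additive (f x₁)) (E-kernel (f-nonzero x₁≢0))
        (trans (E[f,g]≡1 x₁≢0) (sym (trans (cong (λ y → E y (g x₂)) fx₁≡fx₂) (E[f,g]≡1 x₂≢0)))))

module PermutationPolynomials (F : FiniteField) {q n : ℕ} (q-prime-power : IsPrimePower q) (1≤n : 1 ≤ n)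
                              (size≡qⁿ : FiniteField.size F ≡ q ℕ.^ n) where
  open FieldProperties F

  instance
    q≢0 : NonZero q
    q≢0 = primePower⇒nonZero q-prime-power

  frobenius-q : ∀ x y → (x + y) ^ q ≡ x ^ q + y ^ q
  frobenius-q = frobenius-primePower {m = n} q-prime-power size≡qⁿ

  module Part1 (a : Carrier) (L⁻ : Carrier → Carrier) (L∘L⁻ : ∀ y → L⁻ y ^ q + a * L⁻ y ≡ y) where
    L : Carrier → Carrier
    L z = z ^ q + a * z

    L0≡0 : L 0# ≡ 0#
    L0≡0 = trans (cong₂ _+_ (0^m≡0 q) (zeroʳ a)) (+-identityʳ 0#)

    open RightInverse L L⁻ L∘L⁻

    f : Carrier → Carrier
    f x = L⁻ (x ^ (q ℕ.+ 1)) * x ⁻¹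

    E : Carrier → Carrier → Carrier
    E y u = y ^ q * u + a * y * u ^ q

    E-additive : ∀ y u v → E y (u + v) ≡ E y u + E y v
    E-additive y u v = trans (cong (λ t → y ^ q * (u + v) + a * y * t) (frobenius-q u v))
      (solve 6 (λ yq ay u v uq vq → yq :* (u :+ v) :+ ay :* (uq :+ vq) := (yq :* u :+ ay :* uq) :+ (yq :* v :+ ay :* vq))
             refl (y ^ q) (a * y) u v (u ^ q) (v ^ q))

    L[y*d⁻¹] : ∀ y {d} → d ≢ 0# → L (y * d ⁻¹) ≡ E y d * (d ⁻¹ ^ q * d ⁻¹)
    L[y*d⁻¹] y {d} d≢0 = begin
      (y * w) ^ q + a * (y * w)                               ≡⟨ cong (_+ a * (y * w)) (^-distrib-* y w q) ⟩
      y ^ q * w ^ q + a * (y * w)                             ≡⟨ cong₂ _+_ (*-identityʳ _) (*-identityʳ _) ⟨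
      y ^ q * w ^ q * 1# + a * (y * w) * 1#                   ≡⟨ cong₂ (λ s t → y ^ q * w ^ q * s + a * (y * w) * t) dw≡1 (trans (cong (_^ q) dw≡1) (1^m≡1 q)) ⟨
      y ^ q * w ^ q * (d * w) + a * (y * w) * (d * w) ^ q     ≡⟨ cong (λ t → y ^ q * w ^ q * (d * w) + a * (y * w) * t) (^-distrib-* d w q) ⟩
      y ^ q * w ^ q * (d * w) + a * (y * w) * (d ^ q * w ^ q)
        ≡⟨ solve 7 (λ yq wq d w a y dq → yq :* wq :* (d :* w) :+ a :* (y :* w) :* (dq :* wq) := (yq :* d :+ a :* y :* dq) :* (wq :* w))
                 refl (y ^ q) (w ^ q) d w a y (d ^ q) ⟩
      E y d * (w ^ q * w)                                     ∎
      where
      open ≡-Reasoning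
      w : Carrier
      w = d ⁻¹
      dw≡1 : d * w ≡ 1#
      dw≡1 = ⁻¹-inverseʳ d≢0

    E-kernel : ∀ {y} → y ≢ 0# → ∀ d → E y d ≡ 0# → d ≡ 0#
    E-kernel {y} y≢0 d Eyd≡0 with d ≟ 0#
    ... | yes d≡0 = d≡0
    ... | no  d≢0 = contradiction
      (L≡0⇒≡0 L0≡0 (trans (L[y*d⁻¹] y d≢0) (trans (cong (_* (d ⁻¹ ^ q * d ⁻¹)) Eyd≡0) (zeroˡ _))))
      (*-nonzero y≢0 (⁻¹-nonzero d≢0))

    E[f,⁻¹]≡1 : ∀ {x} → x ≢ 0# → E (f x) (x ⁻¹) ≡ 1#
    E[f,⁻¹]≡1 {x} x≢0 = begin
      (z * u) ^ q * u + a * (z * u) * u ^ q   ≡⟨ cong (λ t → t * u + a * (z * u) * u ^ q) (^-distrib-* z u q) ⟩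
      z ^ q * u ^ q * u + a * (z * u) * u ^ q
        ≡⟨ solve 5 (λ zq uq z u a → zq :* uq :* u :+ a :* (z :* u) :* uq := (zq :+ a :* z) :* (uq :* u)) refl (z ^ q) (u ^ q) z u a ⟩
      L z * (u ^ q * u)                        ≡⟨ cong (_* (u ^ q * u)) (trans (L∘L⁻ (x ^ (q ℕ.+ 1))) (x^[m+1]≡x^m*x x q)) ⟩
      x ^ q * x * (u ^ q * u)
        ≡⟨ solve 4 (λ xq x uq u → xq :* x :* (uq :* u) := xq :* uq :* (x :* u)) refl (x ^ q) x (u ^ q) u ⟩
      x ^ q * u ^ q * (x * u)                  ≡⟨ cong₂ _*_ (sym (^-distrib-* x u q)) xu≡1 ⟩
      (x * u) ^ q * 1#                         ≡⟨ cong (λ t → t ^ q * 1#) xu≡1 ⟩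
      1# ^ q * 1#                              ≡⟨ trans (*-identityʳ _) (1^m≡1 q) ⟩
      1#                                       ∎
      where
      open ≡-Reasoning
      z : Carrier
      z = L⁻ (x ^ (q ℕ.+ 1))
      u : Carrier
      u = x ⁻¹
      xu≡1 : x * u ≡ 1#
      xu≡1 = ⁻¹-inverseʳ x≢0

    f0≡0 : f 0# ≡ 0#
    f0≡0 = trans (cong (λ t → L⁻ t * 0# ⁻¹) (trans (x^[m+1]≡x^m*x 0# q) (zeroʳ _)))
                 (trans (cong (_* 0# ⁻¹) (L⁻0≡0 L0≡0)) (zeroˡ _))

    f-nonzero : ∀ {x} → x ≢ 0# → f x ≢ 0#
    f-nonzero x≢0 = *-nonzero (L⁻-nonzero L0≡0 (^-nonzero (q ℕ.+ 1) x≢0)) (⁻¹-nonzero x≢0)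

    f-bijective : Bijective _≡_ _≡_ f
    f-bijective = linearisable⇒bijective f _⁻¹ E f0≡0 f-nonzero ⁻¹-injective E-additive E-kernel E[f,⁻¹]≡1

  Q : ℕ
  Q = q ℕ.^ (n ∸ 1)

  instance
    Q≢0 : NonZero Q
    Q≢0 = ℕₚ.m^n≢0 q (n ∸ 1)

  [x^Q]^q≡x : ∀ x → (x ^ Q) ^ q ≡ x
  [x^Q]^q≡x x = begin
    (x ^ Q) ^ q      ≡⟨ ^-assocʳ x Q q ⟩
    x ^ (Q ℕ.* q)    ≡⟨ cong (x ^_) (ℕₚ.*-comm Q q) ⟩
    x ^ (q ℕ.^ (1 ℕ.+ (n ∸ 1)))  ≡⟨ cong (λ m → x ^ (q ℕ.^ m)) (ℕₚ.m+[n∸m]≡n 1≤n) ⟩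
    x ^ (q ℕ.^ n)    ≡⟨ cong (x ^_) size≡qⁿ ⟨
    x ^ size         ≡⟨ x^size≡x x ⟩
    x                ∎
    where open ≡-Reasoning

  module Part2 (a : Carrier) (L⁻ : Carrier → Carrier) (L∘L⁻ : ∀ y → L⁻ y ^ Q + a * L⁻ y ≡ y) where
    L : Carrier → Carrier
    L z = z ^ Q + a * z

    L0≡0 : L 0# ≡ 0#
    L0≡0 = trans (cong₂ _+_ (0^m≡0 Q) (zeroʳ a)) (+-identityʳ 0#)

    open RightInverse L L⁻ L∘L⁻

    M : Carrier → Carrier
    M w = w + a ^ q * w ^ q

    L^q≡M : ∀ w → L w ^ q ≡ M w
    L^q≡M w = trans (frobenius-q (w ^ Q) (a * w)) (cong₂ _+_ ([x^Q]^q≡x w) (^-distrib-* a w q))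

    M≡0⇒≡0 : ∀ {w} → M w ≡ 0# → w ≡ 0#
    M≡0⇒≡0 {w} Mw≡0 = L≡0⇒≡0 L0≡0 (^≡0⇒≡0 q (trans (L^q≡M w) Mw≡0))

    f : Carrier → Carrier
    f x = L⁻ x * (x ^ (q ℕ.+ 1)) ⁻¹

    E : Carrier → Carrier → Carrier
    E y v = y * v + a ^ q * y ^ q * (v ^ q) ^ q

    E-additive : ∀ y u v → E y (u + v) ≡ E y u + E y v
    E-additive y u v =
      trans (cong (λ t → y * (u + v) + a ^ q * y ^ q * t) (trans (cong (_^ q) (frobenius-q u v)) (frobenius-q (u ^ q) (v ^ q))))
        (solve 6 (λ y c u v uqq vqq → y :* (u :+ v) :+ c :* (uqq :+ vqq) := (y :* u :+ c :* uqq) :+ (y :* v :+ c :* vqq))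
               refl y (a ^ q * y ^ q) u v ((u ^ q) ^ q) ((v ^ q) ^ q))

    M-homogeneous : ∀ y v → M (y * (v ^ q * v)) ≡ v ^ q * E y v
    M-homogeneous y v = begin
      y * (v ^ q * v) + a ^ q * (y * (v ^ q * v)) ^ q
        ≡⟨ cong (λ t → y * (v ^ q * v) + a ^ q * t) (trans (^-distrib-* y _ q) (cong (y ^ q *_) (^-distrib-* (v ^ q) v q))) ⟩
      y * (v ^ q * v) + a ^ q * (y ^ q * ((v ^ q) ^ q * v ^ q))
        ≡⟨ solve 6 (λ y vq v aq yq vqq → y :* (vq :* v) :+ aq :* (yq :* (vqq :* vq)) := vq :* (y :* v :+ aq :* yq :* vqq))
                 refl y (v ^ q) v (a ^ q) (y ^ q) ((v ^ q) ^ q) ⟩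
      v ^ q * E y v
      ∎
      where open ≡-Reasoning

    E-kernel : ∀ {y} → y ≢ 0# → ∀ d → E y d ≡ 0# → d ≡ 0#
    E-kernel {y} y≢0 d Eyd≡0 with d ≟ 0#
    ... | yes d≡0 = d≡0
    ... | no  d≢0 = contradiction
      (M≡0⇒≡0 (trans (M-homogeneous y d) (trans (cong (d ^ q *_) Eyd≡0) (zeroʳ _))))
      (*-nonzero y≢0 (*-nonzero (^-nonzero q d≢0) d≢0))

    E[f,id]≡1 : ∀ {x} → x ≢ 0# → E (f x) x ≡ 1#
    E[f,id]≡1 {x} x≢0 = *-cancelˡ (^-nonzero q x≢0) (begin
      x ^ q * E (f x) x              ≡⟨ M-homogeneous (f x) x ⟨
      M (f x * (x ^ q * x))          ≡⟨ cong M f[x]*X≡L⁻x ⟩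
      M (L⁻ x)                       ≡⟨ L^q≡M (L⁻ x) ⟨
      L (L⁻ x) ^ q                   ≡⟨ cong (_^ q) (L∘L⁻ x) ⟩
      x ^ q                          ≡⟨ *-identityʳ _ ⟨
      x ^ q * 1#                     ∎)
      where
      open ≡-Reasoning
      X : Carrier
      X = x ^ (q ℕ.+ 1)
      f[x]*X≡L⁻x : f x * (x ^ q * x) ≡ L⁻ x
      f[x]*X≡L⁻x = begin
        L⁻ x * X ⁻¹ * (x ^ q * x)   ≡⟨ cong (L⁻ x * X ⁻¹ *_) (x^[m+1]≡x^m*x x q) ⟨
        L⁻ x * X ⁻¹ * X             ≡⟨ *-assoc _ _ _ ⟩
        L⁻ x * (X ⁻¹ * X)           ≡⟨ cong (L⁻ x *_) (trans (*-comm _ _) (⁻¹-inverseʳ (^-nonzero (q ℕ.+ 1) x≢0))) ⟩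
        L⁻ x * 1#                   ≡⟨ *-identityʳ _ ⟩
        L⁻ x                        ∎

    f0≡0 : f 0# ≡ 0#
    f0≡0 = trans (cong (_* (0# ^ (q ℕ.+ 1)) ⁻¹) (L⁻0≡0 L0≡0)) (zeroˡ _)

    f-nonzero : ∀ {x} → x ≢ 0# → f x ≢ 0#
    f-nonzero x≢0 = *-nonzero (L⁻-nonzero L0≡0 x≢0) (⁻¹-nonzero (^-nonzero (q ℕ.+ 1) x≢0))

    f-bijective : Bijective _≡_ _≡_ f
    f-bijective = linearisable⇒bijective f (λ x → x) E f0≡0 f-nonzero (λ _ _ x₁≡x₂ → x₁≡x₂) E-additive E-kernel E[f,id]≡1

mainTheorem3 : (F : FiniteField) (q n : ℕ) → IsPrimePower q → 1 ℕ.≤ n →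
    FiniteField.size F ≡ q ℕ.^ n →
    let open FiniteField F in
    (a : Carrier) → a ≢ 0# →
    prod n (λ i → (- a) ^ (q ℕ.^ i)) ≢ 1# →
    ((Linv : Carrier → Carrier) →
      (∀ y → Linv y ^ q + a * Linv y ≡ y) →
      Bijective _≡_ _≡_ (λ x → Linv (x ^ (q ℕ.+ 1)) * x ^ (q ℕ.^ n ℕ.∸ 2)))
    ×
    ((Linv : Carrier → Carrier) →
      (∀ y → Linv y ^ (q ℕ.^ (n ℕ.∸ 1)) + a * Linv y ≡ y) →
      Bijective _≡_ _≡_ (λ x → Linv x * (x ^ (q ℕ.+ 1)) ^ (q ℕ.^ n ℕ.∸ 2)))
mainTheorem3 F q n q-prime-power 1≤n size≡qⁿ a _ _ =
  (λ Linv L∘Linv → subst (λ m → Bijective _≡_ _≡_ (λ x → Linv (x ^ (q ℕ.+ 1)) * x ^ (m ∸ 2)))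
                         size≡qⁿ (Part1.f-bijective a Linv L∘Linv)) ,
  (λ Linv L∘Linv → subst (λ m → Bijective _≡_ _≡_ (λ x → Linv x * (x ^ (q ℕ.+ 1)) ^ (m ∸ 2)))
                         size≡qⁿ (Part2.f-bijective a Linv L∘Linv))
  where
  open FiniteField F
  open PermutationPolynomials F q-prime-power 1≤n size≡qⁿ
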